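{- Let $k$ be a positive integer and $q$ an indeterminate, and let $V$ be the $(k+1)\times(k+1)$ Vandermonde matrix with entries $V_{r,s}=q^{(r-1)(s-1)}$ for $r,s\in\{1,\dots,k+1\}$ (i.e., column $s$ is $(1,x_s,x_s^2,\dots,x_s^k)^T$ with $x_s=q^{s-1}$). Then for all $i,j\in\{1,\dots,k+1\}$, the rational function \[ (-1)^{i+j}(V^{ -1})_{i,j}\prod_{b=1}^k(q^b-1) \] equals a sum of exactly $\binom{k}{i-1}\binom{k}{j-1}$ (not necessarily distinct) integer powers of $q$. -}

module Defs where

open import Data.Nat as ℕ using (ℕ; suc)
open import Data.Nat.Combinatorics using (_C_)
open import Data.Integer as ℤ using (ℤ; +_; -_; _*_; _+_; _^_)
open import Data.Fin using (Fin; toℕ)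
open import Data.Fin.Properties using () renaming (_≟_ to _≟ᶠ_)
open import Data.List using (List; []; _∷_; _++_; map; foldr; concatMap; length)
open import Data.List.Base using (allFin)
open import Data.Product using (_×_; _,_; proj₁; proj₂)
open import Relation.Binary.PropositionalEquality using (_≡_)
open import Relation.Nullary using (yes; no)

-- Laurent polynomials in the indeterminate q with integer coefficients,
-- represented as formal sums of terms (c , e) meaning c · q^e  (e ∈ ℤ).
LPoly : Set
LPoly = List (ℤ × ℤ)

coeff : LPoly → ℤ → ℤ
coeff [] n = + 0
coeff ((c , e) ∷ p) n with e ℤ.≟ n
... | yes _ = c + coeff p n
... | no  _ = coeff p n

infix 4 _≈ₗ_
_≈ₗ_ : LPoly → LPoly → Set
p ≈ₗ r = ∀ n → coeff p n ≡ coeff r n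

0ₗ : LPoly
0ₗ = []

_+ₗ_ : LPoly → LPoly → LPoly
p +ₗ r = p ++ r

_*ₗ_ : LPoly → LPoly → LPoly
p *ₗ r = concatMap (λ { (c , e) → map (λ { (d , f) → (c * d , e + f) }) r }) p

scaleₗ : ℤ → LPoly → LPoly
scaleₗ a p = map (λ { (c , e) → (a * c , e) }) p

qPow : ℤ → LPoly
qPow e = (+ 1 , e) ∷ []

sumOfPowers : List ℤ → LPoly
sumOfPowers es = map (λ e → (+ 1 , e)) es

prodFactor : ℕ → LPoly
prodFactor 0 = qPow (+ 0)
prodFactor (suc b) = prodFactor b *ₗ (qPow (+ suc b) +ₗ scaleₗ (- + 1) (qPow (+ 0)))

-- Matrices of Laurent polynomials, indexed by Fin n (0-indexed:
-- Fin index r corresponds to the paper's index r+1).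
Mat : ℕ → Set
Mat n = Fin n → Fin n → LPoly

infixl 7 _⊗_
_⊗_ : ∀ {n} → Mat n → Mat n → Mat n
(A ⊗ B) r s = foldr (λ t acc → (A r t *ₗ B t s) +ₗ acc) 0ₗ (allFin _)

infix 4 _≈ₘ_
_≈ₘ_ : ∀ {n} → Mat n → Mat n → Set
A ≈ₘ B = ∀ r s → A r s ≈ₗ B r s

scalarMat : ∀ {n} → LPoly → Mat n
scalarMat d r s with r ≟ᶠ s
... | yes _ = d
... | no  _ = 0ₗ

-- Vandermonde matrix: entry (r,s) (0-indexed) is q^(r·s),
-- i.e. the paper's V_{r+1,s+1} = q^{r s}.
vandermonde : (n : ℕ) → Mat n
vandermonde n r s = qPow (+ (toℕ r ℕ.* toℕ s))

-- (-1)^{i+j} as an integer (parity of 0-indexed i+j equals that of the 1-indexed one)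
sgn : ℕ → ℕ → ℤ
sgn i j = (- + 1) ^ (i ℕ.+ j)

-- Row i of the inverse comes from Lagrange interpolation at the nodes q^0, …, q^k.
-- With r = k − i, the coefficient of y^j in ∏_{x ≠ i} (y − q^x) is ± an elementary
-- symmetric polynomial in the k other nodes, a sum of C(k, j) powers of q, while
-- ∏_{x ≠ i} (q^i − q^x) = (−1)^r q^e ∏_{b ≤ i} (q^b − 1) ∏_{b ≤ r} (q^b − 1).
-- By the q-Pascal rule these two products times the Gaussian binomial [k choose i]_q,
-- a sum of C(k, i) powers of q, give P = ∏_{b ≤ k} (q^b − 1).  So row i of P V⁻¹ is
-- ± q^(−e) [k choose i]_q times the coefficients above, i.e. M V = P I for the claimed M;
-- since V is symmetric and P is not a zero divisor among Laurent polynomials, V M = P I.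
module Submission where

open import Level using (0ℓ)
open import Algebra.Bundles using (CommutativeRing; Semiring)
import Tactic.RingSolver.Core.AlmostCommutativeRing as ACR
open import Tactic.RingSolver using (solve-∀)
open import Data.Nat as ℕ using (ℕ; zero; suc)
import Data.Nat.Properties as ℕₚ
import Data.Nat.Tactic.RingSolver as ℕ-Solver
open import Data.Nat.Combinatorics using (_C_; nCn≡1; nCk+nC[k+1]≡[n+1]C[k+1])
open import Data.Integer as ℤ using (ℤ; +_; -_; -[1+_])
import Data.Integer.Properties as ℤₚ
import Data.Integer.Tactic.RingSolver as ℤ-Solver
open import Data.Fin using (Fin; toℕ)
open import Data.Fin.Properties using () renaming (_≟_ to _≟ᶠ_)
open import Data.List using (List; []; _∷_; _++_; map; concatMap; length; foldr; downFrom)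
import Data.List.Properties as List
open import Data.List.Relation.Unary.All using (All; []; _∷_; all?; lookupWith)
open import Data.List.Relation.Unary.All.Properties using (¬Any⇒All¬)
open import Data.List.Relation.Unary.Any using (here; there; any?)
open import Data.List.Membership.Propositional using (_∈_)
open import Data.List.Membership.Propositional.Properties using (∈-map⁺; ∈-++⁺ˡ; ∈-++⁺ʳ; ∈-downFrom⁺)
open import Data.Maybe using (Maybe; just; nothing)
open import Data.Product using (Σ; _×_; _,_; proj₂)
open import Data.Empty using (⊥-elim)
open import Function using (_∘_)
open import Relation.Binary.Definitions using (tri<; tri≈; tri>)
open import Relation.Binary.PropositionalEquality as ≡
  using (_≡_; _≢_; refl; sym; trans; cong; cong₂; subst; module ≡-Reasoning)
open import Relation.Nullary using (yes; no)

module CommutativeRingLemmas {c ℓ} (𝓡 : CommutativeRing c ℓ) where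
  open CommutativeRing 𝓡 hiding (refl; sym; trans)
  open CommutativeRing 𝓡 using () renaming (refl to ≈-refl; sym to ≈-sym; trans to ≈-trans)
  open import Algebra.Properties.Semiring.Sum semiring
  open import Algebra.Definitions.RawSemiring (Semiring.rawSemiring semiring) public using (_^_)
  open import Algebra.Solver.Ring.NaturalCoefficients.Default commutativeSemiring
    using (solve; _:=_; _:+_; _:*_)
  open import Relation.Binary.Reasoning.Setoid setoid
  open import Data.Fin.Properties using (punchInᵢ≢i)

  sum-concentrated : ∀ {n} (f : Fin n → Carrier) w → (∀ u → u ≢ w → f u ≈ 0#) → sum f ≈ f w
  sum-concentrated {suc n} f w elsewhere = begin
    sum f                     ≈⟨ sum-remove f ⟩
    f w + sum (removeAt f w)  ≈⟨ +-congˡ (≈-trans (sum-cong-≋ λ j → elsewhere _ (punchInᵢ≢i w j))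
                                                  (sum-replicate-zero n)) ⟩
    f w + 0#                  ≈⟨ +-identityʳ (f w) ⟩
    f w                       ∎
    where open import Data.Vec.Functional using (removeAt)

  Matrix : ℕ → Set c
  Matrix n = Fin n → Fin n → Carrier

  infixl 7 _·_
  _·_ : ∀ {n} → Matrix n → Matrix n → Matrix n
  (A · B) r s = ∑[ t < _ ] (A r t * B t s)

  IsScalar : ∀ {n} → Carrier → Matrix n → Set ℓ
  IsScalar p A = (∀ r → A r r ≈ p) × (∀ r s → r ≢ s → A r s ≈ 0#)

  ·-assoc : ∀ {n} (A B C : Matrix n) r s → ((A · B) · C) r s ≈ (A · (B · C)) r s
  ·-assoc {n} A B C r s = begin
    ∑[ u < n ] (∑[ t < n ] (A r t * B t u) * C u s)
      ≈⟨ sum-cong-≋ {n} (λ u → *-distribʳ-sum (C u s) (λ t → A r t * B t u)) ⟩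
    ∑[ u < n ] ∑[ t < n ] (A r t * B t u * C u s)
      ≈⟨ ∑-comm (λ u t → A r t * B t u * C u s) ⟩
    ∑[ t < n ] ∑[ u < n ] (A r t * B t u * C u s)
      ≈⟨ sum-cong-≋ {n} (λ t → ≈-trans (sum-cong-≋ {n} (λ u → *-assoc (A r t) (B t u) (C u s)))
                                       (≈-sym (*-distribˡ-sum (A r t) (λ u → B t u * C u s)))) ⟩
    ∑[ t < n ] (A r t * ∑[ u < n ] (B t u * C u s)) ∎

  ·-scalarˡ : ∀ {n p} {D : Matrix n} → IsScalar p D → ∀ A r s → (D · A) r s ≈ p * A r s
  ·-scalarˡ {n} {D = D} (diagonal , offDiagonal) A r s = begin
    ∑[ t < n ] (D r t * A t s)
      ≈⟨ sum-concentrated _ r (λ t t≢r → ≈-trans (*-congʳ (offDiagonal r t (t≢r ∘ ≡.sym))) (zeroˡ _)) ⟩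
    D r r * A r s
      ≈⟨ *-congʳ (diagonal r) ⟩
    _ * A r s ∎

  ·-scalarʳ : ∀ {n p} {D : Matrix n} → IsScalar p D → ∀ A r s → (A · D) r s ≈ A r s * p
  ·-scalarʳ {n} {D = D} (diagonal , offDiagonal) A r s = begin
    ∑[ t < n ] (A r t * D t s)
      ≈⟨ sum-concentrated _ s (λ t t≢s → ≈-trans (*-congˡ (offDiagonal t s t≢s)) (zeroʳ _)) ⟩
    A r s * D s s
      ≈⟨ *-congˡ (diagonal s) ⟩
    A r s * _ ∎

  -- With MV = pI and V symmetric, p (VM)ᵀ = M V (VM)ᵀ = M (VMV)ᵀ = p MV; cancelling p, VM = (MV)ᵀ.
  ·-comm-scalar : ∀ {n p} (M V : Matrix n) → (∀ {a b} → p * a ≈ p * b → a ≈ b) →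
    (∀ r s → V r s ≈ V s r) → IsScalar p (M · V) → IsScalar p (V · M)
  ·-comm-scalar {n} {p} M V cancel V-symmetric MV-scalar@(diagonal , offDiagonal) =
    (λ r → ≈-trans (VM≈MVᵀ r r) (diagonal r)) ,
    (λ r s r≢s → ≈-trans (VM≈MVᵀ r s) (offDiagonal s r (r≢s ∘ ≡.sym)))
    where
    VMᵀ : Matrix n
    VMᵀ a b = (V · M) b a

    V·VMᵀ : ∀ s r → (V · VMᵀ) s r ≈ V s r * p
    V·VMᵀ s r = begin
      ∑[ u < n ] (V s u * (V · M) r u)  ≈⟨ sum-cong-≋ {n} (λ u → ≈-trans (*-comm _ _) (*-congˡ (V-symmetric s u))) ⟩
      ((V · M) · V) r s                 ≈⟨ ·-assoc V M V r s ⟩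
      (V · (M · V)) r s                 ≈⟨ ·-scalarʳ MV-scalar V r s ⟩
      V r s * p                         ≈⟨ *-congʳ (V-symmetric r s) ⟩
      V s r * p                         ∎

    VM≈MVᵀ : ∀ r w → (V · M) r w ≈ (M · V) w r
    VM≈MVᵀ r w = cancel (begin
      p * VMᵀ w r                         ≈⟨ ·-scalarˡ MV-scalar VMᵀ w r ⟨
      ((M · V) · VMᵀ) w r                 ≈⟨ ·-assoc M V VMᵀ w r ⟩
      ∑[ s < n ] (M w s * (V · VMᵀ) s r)  ≈⟨ sum-cong-≋ {n} (λ s → ≈-trans (*-congˡ (V·VMᵀ s r))
                                                                           (≈-sym (*-assoc (M w s) (V s r) p))) ⟩
      ∑[ s < n ] (M w s * V s r * p)      ≈⟨ *-distribʳ-sum p (λ s → M w s * V s r) ⟨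
      (M · V) w r * p                     ≈⟨ *-comm ((M · V) w r) p ⟩
      p * (M · V) w r                     ∎)

  polyEval : ℕ → (ℕ → Carrier) → Carrier → Carrier
  polyEval N a y = ∑[ j < N ] (a (toℕ j) * y ^ toℕ j)

  polyEval-cong : ∀ N {a b} y → (∀ j → a j ≈ b j) → polyEval N a y ≈ polyEval N b y
  polyEval-cong N y a≈b = sum-cong-≋ {N} (λ j → *-congʳ (a≈b (toℕ j)))

  polyEval-*ˡ : ∀ N u a y → polyEval N (λ j → u * a j) y ≈ u * polyEval N a y
  polyEval-*ˡ N u a y = begin
    ∑[ j < N ] (u * a (toℕ j) * y ^ toℕ j)    ≈⟨ sum-cong-≋ {N} (λ j → *-assoc u (a (toℕ j)) (y ^ toℕ j)) ⟩
    ∑[ j < N ] (u * (a (toℕ j) * y ^ toℕ j))  ≈⟨ *-distribˡ-sum {N} u (λ j → a (toℕ j) * y ^ toℕ j) ⟨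
    u * polyEval N a y                        ∎

  polyEval-constant : ∀ N {a} y → (∀ j → a (suc j) ≈ 0#) → polyEval (suc N) a y ≈ a 0
  polyEval-constant N {a} y a≈0 = begin
    a 0 * 1# + ∑[ j < N ] (a (suc (toℕ j)) * (y * y ^ toℕ j))
      ≈⟨ +-cong (*-identityʳ (a 0)) (sum-cong-≋ {N} (λ j → ≈-trans (*-congʳ (a≈0 (toℕ j))) (zeroˡ _))) ⟩
    a 0 + ∑[ j < N ] 0#
      ≈⟨ +-congˡ (sum-replicate-zero N) ⟩
    a 0 + 0#
      ≈⟨ +-identityʳ (a 0) ⟩
    a 0 ∎

  polyEval-linearFactor : ∀ N {a a′} b y → a′ 0 ≈ b * a 0 → (∀ j → a′ (suc j) ≈ a j + b * a (suc j)) →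
    polyEval (suc N) a′ y ≈ y * polyEval N a y + b * polyEval (suc N) a y
  polyEval-linearFactor N {a} {a′} b y a′₀ a′ₛ = begin
    a′ 0 * 1# + ∑[ j < N ] (a′ (suc (toℕ j)) * (y * y ^ toℕ j))
      ≈⟨ +-cong (*-congʳ a′₀) (sum-cong-≋ {N} λ j → ≈-trans (*-congʳ (a′ₛ (toℕ j))) (split (toℕ j))) ⟩
    b * a 0 * 1# + ∑[ j < N ] (y * (a (toℕ j) * y ^ toℕ j) + b * (a (suc (toℕ j)) * (y * y ^ toℕ j)))
      ≈⟨ +-congˡ (≈-trans (∑-distrib-+ {N} (λ j → y * (a (toℕ j) * y ^ toℕ j))
                                           (λ j → b * (a (suc (toℕ j)) * (y * y ^ toℕ j))))
                          (+-cong (≈-sym (*-distribˡ-sum {N} y (λ j → a (toℕ j) * y ^ toℕ j)))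
                                  (≈-sym (*-distribˡ-sum {N} b (λ j → a (suc (toℕ j)) * (y * y ^ toℕ j)))))) ⟩
    b * a 0 * 1# + (y * polyEval N a y + b * ∑[ j < N ] (a (suc (toℕ j)) * (y * y ^ toℕ j)))
      ≈⟨ regroup y b (a 0) 1# (polyEval N a y) _ ⟩
    y * polyEval N a y + b * (a 0 * 1# + ∑[ j < N ] (a (suc (toℕ j)) * (y * y ^ toℕ j))) ∎
    where
    split : ∀ j → (a j + b * a (suc j)) * (y * y ^ j)
                    ≈ y * (a j * y ^ j) + b * (a (suc j) * (y * y ^ j))
    split j = solve 5 (λ u v b y z → (u :+ b :* v) :* (y :* z) := y :* (u :* z) :+ b :* (v :* (y :* z)))
                ≈-refl (a j) (a (suc j)) b y (y ^ j)
    regroup : ∀ y b u o P S → b * u * o + (y * P + b * S) ≈ y * P + b * (u * o + S)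
    regroup = solve 6 (λ y b u o P S → b :* u :* o :+ (y :* P :+ b :* S) := y :* P :+ b :* (u :* o :+ S))
                ≈-refl

-- Laurent polynomials form a commutative ring

open import Defs renaming (_+ₗ_ to infixl 6 _+ₗ_; _*ₗ_ to infixl 7 _*ₗ_)

module _ where
  open import Data.Integer using (_+_; _*_; _-_)
  open ≡-Reasoning

  indicator : ℤ → ℤ → ℤ
  indicator n e with e ℤ.≟ n
  ... | yes _ = + 1
  ... | no  _ = + 0

  -- Σ c q^e ↦ Σ c F(e).  The ring laws are checked on pairings, where the order and
  -- grouping of the terms of a list no longer matter.
  pairing : LPoly → (ℤ → ℤ) → ℤ
  pairing []            F = + 0
  pairing ((c , e) ∷ p) F = c * F e + pairing p F

  coeff≡pairing : ∀ p n → coeff p n ≡ pairing p (indicator n)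
  coeff≡pairing []            n = refl
  coeff≡pairing ((c , e) ∷ p) n with e ℤ.≟ n
  ... | yes _ = cong₂ _+_ (sym (ℤₚ.*-identityʳ c)) (coeff≡pairing p n)
  ... | no  _ = trans (coeff≡pairing p n) (sym (trans (cong (_+ _) (ℤₚ.*-zeroʳ c)) (ℤₚ.+-identityˡ _)))

  indicator-translate : ∀ n e f → indicator n (e + f) ≡ indicator (n - e) f
  indicator-translate n e f with e + f ℤ.≟ n | f ℤ.≟ n - e
  ... | yes _  | yes _  = refl
  ... | no  _  | no  _  = refl
  ... | yes eq | no neq = ⊥-elim (neq (trans (sym (cancel e f)) (cong (_- e) eq)))
    where cancel : ∀ e f → e + f - e ≡ f
          cancel = ℤ-Solver.solve-∀
  ... | no neq | yes eq = ⊥-elim (neq (trans (cong (_+_ e) eq) (cancel e n)))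
    where cancel : ∀ e n → e + (n - e) ≡ n
          cancel = ℤ-Solver.solve-∀

  pairing-cong : ∀ p {F G} → (∀ e → F e ≡ G e) → pairing p F ≡ pairing p G
  pairing-cong []            F≗G = refl
  pairing-cong ((c , e) ∷ p) F≗G = cong₂ (λ x y → c * x + y) (F≗G e) (pairing-cong p F≗G)

  pairing-++ : ∀ p r F → pairing (p ++ r) F ≡ pairing p F + pairing r F
  pairing-++ []            r F = sym (ℤₚ.+-identityˡ _)
  pairing-++ ((c , e) ∷ p) r F =
    trans (cong (_+_ (c * F e)) (pairing-++ p r F)) (sym (ℤₚ.+-assoc (c * F e) _ _))

  pairing-+ : ∀ p F G → pairing p (λ e → F e + G e) ≡ pairing p F + pairing p G
  pairing-+ []            F G = refl
  pairing-+ ((c , e) ∷ p) F G =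
    trans (cong (_+_ (c * (F e + G e))) (pairing-+ p F G)) (shuffle c (F e) (G e) _ _)
    where shuffle : ∀ c a b x y → c * (a + b) + (x + y) ≡ c * a + x + (c * b + y)
          shuffle = ℤ-Solver.solve-∀

  pairing-*ˡ : ∀ p a F → pairing p (λ e → a * F e) ≡ a * pairing p F
  pairing-*ˡ []            a F = sym (ℤₚ.*-zeroʳ a)
  pairing-*ˡ ((c , e) ∷ p) a F =
    trans (cong (_+_ (c * (a * F e))) (pairing-*ˡ p a F)) (shuffle c a (F e) _)
    where shuffle : ∀ c a b x → c * (a * b) + a * x ≡ a * (c * b + x)
          shuffle = ℤ-Solver.solve-∀

  pairing-zero : ∀ p → pairing p (λ _ → + 0) ≡ + 0
  pairing-zero []            = refl
  pairing-zero ((c , e) ∷ p) = cong₂ _+_ (ℤₚ.*-zeroʳ c) (pairing-zero p)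

  pairing-swap : ∀ p r (X : ℤ → ℤ → ℤ) →
    pairing p (λ e → pairing r (X e)) ≡ pairing r (λ f → pairing p (λ e → X e f))
  pairing-swap []            r X = sym (pairing-zero r)
  pairing-swap ((c , e) ∷ p) r X = begin
    c * pairing r (X e) + pairing p (λ e → pairing r (X e))
      ≡⟨ cong₂ _+_ (sym (pairing-*ˡ r c (X e))) (pairing-swap p r X) ⟩
    pairing r (λ f → c * X e f) + pairing r (λ f → pairing p (λ e → X e f))
      ≡⟨ sym (pairing-+ r _ _) ⟩
    pairing r (λ f → c * X e f + pairing p (λ e → X e f)) ∎

  pairing-scale : ∀ a p F → pairing (scaleₗ a p) F ≡ a * pairing p F
  pairing-scale a []            F = sym (ℤₚ.*-zeroʳ a)
  pairing-scale a ((c , e) ∷ p) F =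
    trans (cong₂ _+_ (ℤₚ.*-assoc a c (F e)) (pairing-scale a p F))
          (sym (ℤₚ.*-distribˡ-+ a (c * F e) _))

  pairing-translate : ∀ c e r F →
    pairing (map (λ { (d , f) → (c * d , e + f) }) r) F ≡ c * pairing r (λ f → F (e + f))
  pairing-translate c e []            F = sym (ℤₚ.*-zeroʳ c)
  pairing-translate c e ((d , f) ∷ r) F =
    trans (cong₂ _+_ (ℤₚ.*-assoc c d (F (e + f))) (pairing-translate c e r F))
          (sym (ℤₚ.*-distribˡ-+ c (d * F (e + f)) _))

  pairing-* : ∀ p r F → pairing (p *ₗ r) F ≡ pairing p (λ e → pairing r (λ f → F (e + f)))
  pairing-* []            r F = refl
  pairing-* ((c , e) ∷ p) r F =
    trans (pairing-++ (map _ r) (p *ₗ r) F)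
          (cong₂ _+_ (pairing-translate c e r F) (pairing-* p r F))

  coeff-++ : ∀ p r n → coeff (p ++ r) n ≡ coeff p n + coeff r n
  coeff-++ p r n = begin
    coeff (p ++ r) n                                   ≡⟨ coeff≡pairing (p ++ r) n ⟩
    pairing (p ++ r) (indicator n)                     ≡⟨ pairing-++ p r _ ⟩
    pairing p (indicator n) + pairing r (indicator n)  ≡⟨ cong₂ _+_ (coeff≡pairing p n) (coeff≡pairing r n) ⟨
    coeff p n + coeff r n                              ∎

  coeff-scale : ∀ a p n → coeff (scaleₗ a p) n ≡ a * coeff p n
  coeff-scale a p n = begin
    coeff (scaleₗ a p) n              ≡⟨ coeff≡pairing (scaleₗ a p) n ⟩
    pairing (scaleₗ a p) (indicator n) ≡⟨ pairing-scale a p _ ⟩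
    a * pairing p (indicator n)        ≡⟨ cong (a *_) (sym (coeff≡pairing p n)) ⟩
    a * coeff p n                      ∎

  coeff-* : ∀ p r n → coeff (p *ₗ r) n ≡ pairing p (λ e → coeff r (n - e))
  coeff-* p r n = begin
    coeff (p *ₗ r) n
      ≡⟨ coeff≡pairing (p *ₗ r) n ⟩
    pairing (p *ₗ r) (indicator n)
      ≡⟨ pairing-* p r _ ⟩
    pairing p (λ e → pairing r (λ f → indicator n (e + f)))
      ≡⟨ pairing-cong p (λ e → pairing-cong r (indicator-translate n e)) ⟩
    pairing p (λ e → pairing r (indicator (n - e)))
      ≡⟨ pairing-cong p (λ e → sym (coeff≡pairing r (n - e))) ⟩
    pairing p (λ e → coeff r (n - e)) ∎

-- Wrapping _≈ₗ_ in a record makes both sides recoverable from the type,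
-- which implicit-argument inference in the ring library relies on.
infix 4 _≋_
record _≋_ (p r : LPoly) : Set where
  constructor ≈⇒≋
  field ≋⇒≈ : p ≈ₗ r
open _≋_ public

infix 8 -ₗ_
-ₗ_ : LPoly → LPoly
-ₗ p = scaleₗ (- + 1) p

1ₗ : LPoly
1ₗ = qPow (+ 0)

constant : ℤ → LPoly
constant a = (a , + 0) ∷ []

module RingLaws where
  open import Data.Integer using (_+_; _*_; _-_)
  open ≡-Reasoning

  pairing⇒≋ : ∀ {p r} → (∀ F → pairing p F ≡ pairing r F) → p ≋ r
  pairing⇒≋ {p} {r} h = ≈⇒≋ λ n → begin
    coeff p n               ≡⟨ coeff≡pairing p n ⟩
    pairing p (indicator n) ≡⟨ h (indicator n) ⟩
    pairing r (indicator n) ≡⟨ sym (coeff≡pairing r n) ⟩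
    coeff r n               ∎

  ≡⇒≋ : ∀ {p r} → p ≡ r → p ≋ r
  ≡⇒≋ refl = ≈⇒≋ λ _ → refl

  ≋-sym : ∀ {p r} → p ≋ r → r ≋ p
  ≋-sym (≈⇒≋ eq) = ≈⇒≋ λ n → sym (eq n)

  ≋-trans : ∀ {p r s} → p ≋ r → r ≋ s → p ≋ s
  ≋-trans (≈⇒≋ eq) (≈⇒≋ eq′) = ≈⇒≋ λ n → trans (eq n) (eq′ n)

  +-cong : ∀ {p p′ r r′} → p ≋ p′ → r ≋ r′ → p +ₗ r ≋ p′ +ₗ r′
  +-cong {p} {p′} {r} {r′} (≈⇒≋ eq) (≈⇒≋ eq′) = ≈⇒≋ λ n →
    trans (coeff-++ p r n) (trans (cong₂ _+_ (eq n) (eq′ n)) (sym (coeff-++ p′ r′ n)))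

  -‿cong : ∀ {p r} → p ≋ r → -ₗ p ≋ -ₗ r
  -‿cong {p} {r} (≈⇒≋ eq) = ≈⇒≋ λ n →
    trans (coeff-scale (- + 1) p n) (trans (cong (- + 1 *_) (eq n)) (sym (coeff-scale (- + 1) r n)))

  +-assoc : ∀ p r s → (p +ₗ r) +ₗ s ≋ p +ₗ (r +ₗ s)
  +-assoc p r s = ≡⇒≋ (List.++-assoc p r s)

  +-comm : ∀ p r → p +ₗ r ≋ r +ₗ p
  +-comm p r = pairing⇒≋ λ F →
    trans (pairing-++ p r F) (trans (ℤₚ.+-comm (pairing p F) (pairing r F)) (sym (pairing-++ r p F)))

  +-identityʳ : ∀ p → p +ₗ 0ₗ ≋ p
  +-identityʳ p = ≡⇒≋ (List.++-identityʳ p)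

  -‿inverseˡ : ∀ p → (-ₗ p) +ₗ p ≋ 0ₗ
  -‿inverseˡ p = pairing⇒≋ λ F → begin
    pairing ((-ₗ p) ++ p) F                   ≡⟨ pairing-++ (-ₗ p) p F ⟩
    pairing (-ₗ p) F + pairing p F            ≡⟨ cong (_+ pairing p F) (pairing-scale (- + 1) p F) ⟩
    - + 1 * pairing p F + pairing p F         ≡⟨ cancel (pairing p F) ⟩
    + 0                                       ∎
    where cancel : ∀ x → - + 1 * x + x ≡ + 0
          cancel = ℤ-Solver.solve-∀

  -‿inverseʳ : ∀ p → p +ₗ (-ₗ p) ≋ 0ₗ
  -‿inverseʳ p = ≋-trans (+-comm p (-ₗ p)) (-‿inverseˡ p)

  *-comm : ∀ p r → p *ₗ r ≋ r *ₗ p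
  *-comm p r = pairing⇒≋ λ F → begin
    pairing (p *ₗ r) F
      ≡⟨ pairing-* p r F ⟩
    pairing p (λ e → pairing r (λ f → F (e + f)))
      ≡⟨ pairing-swap p r _ ⟩
    pairing r (λ f → pairing p (λ e → F (e + f)))
      ≡⟨ pairing-cong r (λ f → pairing-cong p (λ e → cong F (ℤₚ.+-comm e f))) ⟩
    pairing r (λ f → pairing p (λ e → F (f + e)))
      ≡⟨ pairing-* r p F ⟨
    pairing (r *ₗ p) F ∎

  *-assoc : ∀ p r s → (p *ₗ r) *ₗ s ≋ p *ₗ (r *ₗ s)
  *-assoc p r s = pairing⇒≋ λ F → begin
    pairing ((p *ₗ r) *ₗ s) F
      ≡⟨ pairing-* (p *ₗ r) s F ⟩
    pairing (p *ₗ r) (λ g → pairing s (λ h → F (g + h)))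
      ≡⟨ pairing-* p r _ ⟩
    pairing p (λ e → pairing r (λ f → pairing s (λ h → F (e + f + h))))
      ≡⟨ pairing-cong p (λ e → pairing-cong r (λ f → pairing-cong s (λ h → cong F (ℤₚ.+-assoc e f h)))) ⟩
    pairing p (λ e → pairing r (λ f → pairing s (λ h → F (e + (f + h)))))
      ≡⟨ pairing-cong p (λ e → sym (pairing-* r s _)) ⟩
    pairing p (λ e → pairing (r *ₗ s) (λ g → F (e + g)))
      ≡⟨ sym (pairing-* p (r *ₗ s) F) ⟩
    pairing (p *ₗ (r *ₗ s)) F ∎

  *-identityˡ : ∀ p → 1ₗ *ₗ p ≋ p
  *-identityˡ p = pairing⇒≋ λ F → begin
    pairing (1ₗ *ₗ p) F                        ≡⟨ pairing-* 1ₗ p F ⟩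
    + 1 * pairing p (λ f → F (+ 0 + f)) + + 0  ≡⟨ ℤₚ.+-identityʳ _ ⟩
    + 1 * pairing p (λ f → F (+ 0 + f))        ≡⟨ ℤₚ.*-identityˡ _ ⟩
    pairing p (λ f → F (+ 0 + f))              ≡⟨ pairing-cong p (λ f → cong F (ℤₚ.+-identityˡ f)) ⟩
    pairing p F                                ∎

  *-identityʳ : ∀ p → p *ₗ 1ₗ ≋ p
  *-identityʳ p = ≋-trans (*-comm p 1ₗ) (*-identityˡ p)

  distribʳ : ∀ s p r → (p +ₗ r) *ₗ s ≋ (p *ₗ s) +ₗ (r *ₗ s)
  distribʳ s p r = ≡⇒≋ (List.concatMap-++ _ p r)

  distribˡ : ∀ s p r → s *ₗ (p +ₗ r) ≋ (s *ₗ p) +ₗ (s *ₗ r)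
  distribˡ s p r = pairing⇒≋ λ F → begin
    pairing (s *ₗ (p ++ r)) F
      ≡⟨ pairing-* s (p ++ r) F ⟩
    pairing s (λ e → pairing (p ++ r) (λ f → F (e + f)))
      ≡⟨ pairing-cong s (λ e → pairing-++ p r _) ⟩
    pairing s (λ e → pairing p (λ f → F (e + f)) + pairing r (λ f → F (e + f)))
      ≡⟨ pairing-+ s _ _ ⟩
    pairing s (λ e → pairing p (λ f → F (e + f))) + pairing s (λ e → pairing r (λ f → F (e + f)))
      ≡⟨ sym (cong₂ _+_ (pairing-* s p F) (pairing-* s r F)) ⟩
    pairing (s *ₗ p) F + pairing (s *ₗ r) F
      ≡⟨ sym (pairing-++ (s *ₗ p) (s *ₗ r) F) ⟩
    pairing ((s *ₗ p) ++ (s *ₗ r)) F ∎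

  scale≋constant* : ∀ a p → scaleₗ a p ≋ constant a *ₗ p
  scale≋constant* a p = pairing⇒≋ λ F → sym (begin
    pairing (constant a *ₗ p) F                ≡⟨ pairing-* (constant a) p F ⟩
    a * pairing p (λ f → F (+ 0 + f)) + + 0    ≡⟨ ℤₚ.+-identityʳ _ ⟩
    a * pairing p (λ f → F (+ 0 + f))          ≡⟨ cong (a *_) (pairing-cong p (λ f → cong F (ℤₚ.+-identityˡ f))) ⟩
    a * pairing p F                            ≡⟨ pairing-scale a p F ⟨
    pairing (scaleₗ a p) F                     ∎)

  *-congˡ : ∀ p {r r′} → r ≋ r′ → p *ₗ r ≋ p *ₗ r′
  *-congˡ p {r} {r′} (≈⇒≋ eq) = ≈⇒≋ λ n →
    trans (coeff-* p r n) (trans (pairing-cong p (λ e → eq (n - e))) (sym (coeff-* p r′ n)))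

  *-cong : ∀ {p p′ r r′} → p ≋ p′ → r ≋ r′ → p *ₗ r ≋ p′ *ₗ r′
  *-cong {p} {p′} {r} {r′} p≋p′ r≋r′ =
    ≋-trans (*-congˡ p r≋r′) (≋-trans (*-comm p r′) (≋-trans (*-congˡ r′ p≋p′) (*-comm r′ p′)))

laurentRing : CommutativeRing 0ℓ 0ℓ
laurentRing = record
  { Carrier = LPoly ; _≈_ = _≋_ ; _+_ = _+ₗ_ ; _*_ = _*ₗ_ ; -_ = -ₗ_ ; 0# = 0ₗ ; 1# = 1ₗ
  ; isCommutativeRing = record
    { isRing = record
      { +-isAbelianGroup = record
        { isGroup = record
          { isMonoid = record
            { isSemigroup = record
              { isMagma = record
                { isEquivalence = record { refl = ≈⇒≋ λ _ → refl ; sym = ≋-sym ; trans = ≋-trans }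
                ; ∙-cong = +-cong }
              ; assoc = +-assoc }
            ; identity = (λ _ → ≈⇒≋ λ _ → refl) , +-identityʳ }
          ; inverse = -‿inverseˡ , -‿inverseʳ
          ; ⁻¹-cong = -‿cong }
        ; comm = +-comm }
      ; *-cong = *-cong
      ; *-assoc = *-assoc
      ; *-identity = *-identityˡ , *-identityʳ
      ; distrib = distribˡ , distribʳ }
    ; *-comm = *-comm } }
  where open RingLaws

coeff-absent : ∀ p n → All (λ t → proj₂ t ≢ n) p → coeff p n ≡ + 0
coeff-absent []            n []           = refl
coeff-absent ((c , e) ∷ p) n (e≢n ∷ rest) with e ℤ.≟ n
... | yes e≡n = ⊥-elim (e≢n e≡n)
... | no  _   = coeff-absent p n rest

-- The ring solver cancels coefficients only through this zero test.
zero? : ∀ p → Maybe (0ₗ ≋ p)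
zero? p with all? (λ t → coeff p (proj₂ t) ℤ.≟ + 0) p
... | no  _        = nothing
... | yes vanishes = just (≈⇒≋ λ n → sym (vanish n))
  where
  vanish : ∀ n → coeff p n ≡ + 0
  vanish n with any? (λ t → proj₂ t ℤ.≟ n) p
  ... | yes occurs = lookupWith {R = λ _ → coeff p n ≡ + 0}
                       (λ vanishes-at t≡n → subst (λ m → coeff p m ≡ + 0) t≡n vanishes-at) vanishes occurs
  ... | no  absent = coeff-absent p n (¬Any⇒All¬ p absent)

laurentSolverRing : ACR.AlmostCommutativeRing 0ℓ 0ℓ
laurentSolverRing = ACR.fromCommutativeRing laurentRing zero?

module R = CommutativeRing laurentRing
open RingLaws using (scale≋constant*)

open import Algebra.Properties.Ring R.ring using (-‿involutive; -‿distribˡ-*; -‿distribʳ-*; x∙y⁻¹≈ε⇒x≈y)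
open CommutativeRingLemmas laurentRing
  using (_·_; IsScalar; ·-comm-scalar; _^_; polyEval; polyEval-cong; polyEval-*ˡ; polyEval-constant
        ; polyEval-linearFactor)

-- Sums of powers of q, recorded by their exponents

module _ where
  open ≡-Reasoning

  shift : ℤ → List ℤ → List ℤ
  shift a = map (ℤ._+_ a)

  infixl 7 _⊠_
  _⊠_ : List ℤ → List ℤ → List ℤ
  xs ⊠ ys = concatMap (λ x → shift x ys) xs

  sumOfPowers-++ : ∀ xs ys → sumOfPowers (xs ++ ys) ≡ sumOfPowers xs +ₗ sumOfPowers ys
  sumOfPowers-++ xs ys = List.map-++ _ xs ys

  sumOfPowers-shift : ∀ a xs → sumOfPowers (shift a xs) ≡ qPow a *ₗ sumOfPowers xs
  sumOfPowers-shift a []       = refl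
  sumOfPowers-shift a (x ∷ xs) = cong ((+ 1 , a ℤ.+ x) ∷_) (sumOfPowers-shift a xs)

  sumOfPowers-⊠ : ∀ xs ys → sumOfPowers (xs ⊠ ys) ≡ sumOfPowers xs *ₗ sumOfPowers ys
  sumOfPowers-⊠ []       ys = refl
  sumOfPowers-⊠ (x ∷ xs) ys = begin
    sumOfPowers (shift x ys ++ xs ⊠ ys)
      ≡⟨ sumOfPowers-++ (shift x ys) (xs ⊠ ys) ⟩
    sumOfPowers (shift x ys) ++ sumOfPowers (xs ⊠ ys)
      ≡⟨ cong₂ _++_ (trans (sumOfPowers-shift x ys) (List.++-identityʳ _)) (sumOfPowers-⊠ xs ys) ⟩
    sumOfPowers (x ∷ xs) *ₗ sumOfPowers ys ∎

  length-shift : ∀ a xs → length (shift a xs) ≡ length xs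
  length-shift a = List.length-map (ℤ._+_ a)

  length-⊠ : ∀ xs ys → length (xs ⊠ ys) ≡ length xs ℕ.* length ys
  length-⊠ []       ys = refl
  length-⊠ (x ∷ xs) ys = begin
    length (shift x ys ++ xs ⊠ ys)             ≡⟨ List.length-++ (shift x ys) ⟩
    length (shift x ys) ℕ.+ length (xs ⊠ ys)   ≡⟨ cong₂ ℕ._+_ (length-shift x ys) (length-⊠ xs ys) ⟩
    length ys ℕ.+ length xs ℕ.* length ys      ∎

  -- The exponents of the Gaussian binomial [i + r choose i]_q, by the q-Pascal rule.
  qBinomial : ℕ → ℕ → List ℤ
  qBinomial zero    r       = + 0 ∷ []
  qBinomial (suc i) zero    = + 0 ∷ []
  qBinomial (suc i) (suc r) = qBinomial i (suc r) ++ shift (+ suc i) (qBinomial (suc i) r)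

  length-qBinomial : ∀ i r → length (qBinomial i r) ≡ (i ℕ.+ r) C i
  length-qBinomial zero    r       = refl
  length-qBinomial (suc i) zero    = sym (trans (cong (_C suc i) (ℕₚ.+-identityʳ (suc i))) (nCn≡1 (suc i)))
  length-qBinomial (suc i) (suc r) = begin
    length (qBinomial i (suc r) ++ shift (+ suc i) (qBinomial (suc i) r))
      ≡⟨ List.length-++ (qBinomial i (suc r)) ⟩
    length (qBinomial i (suc r)) ℕ.+ length (shift (+ suc i) (qBinomial (suc i) r))
      ≡⟨ cong₂ ℕ._+_ (length-qBinomial i (suc r))
                     (trans (length-shift (+ suc i) (qBinomial (suc i) r)) (length-qBinomial (suc i) r)) ⟩
    (i ℕ.+ suc r) C i ℕ.+ (suc i ℕ.+ r) C suc i
      ≡⟨ cong (λ n → (i ℕ.+ suc r) C i ℕ.+ n C suc i) (sym (ℕₚ.+-suc i r)) ⟩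
    (i ℕ.+ suc r) C i ℕ.+ (i ℕ.+ suc r) C suc i
      ≡⟨ nCk+nC[k+1]≡[n+1]C[k+1] (i ℕ.+ suc r) i ⟩
    (suc i ℕ.+ suc r) C suc i ∎

  -- vietaExponents xs j lists the monomials of the elementary symmetric polynomial
  -- e_{n-j}(q^x : x ∈ xs), n = length xs: up to the sign (-1)^{n-j}, the coefficient
  -- of y^j in ∏_{x ∈ xs} (y - q^x).
  vietaExponents : List ℤ → ℕ → List ℤ
  vietaExponents []       zero    = + 0 ∷ []
  vietaExponents []       (suc j) = []
  vietaExponents (x ∷ xs) zero    = shift x (vietaExponents xs zero)
  vietaExponents (x ∷ xs) (suc j) = vietaExponents xs j ++ shift x (vietaExponents xs (suc j))

  length-vietaExponents : ∀ xs j → length (vietaExponents xs j) ≡ length xs C j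
  length-vietaExponents []       zero    = refl
  length-vietaExponents []       (suc j) = refl
  length-vietaExponents (x ∷ xs) zero    =
    trans (length-shift x (vietaExponents xs zero)) (length-vietaExponents xs zero)
  length-vietaExponents (x ∷ xs) (suc j) = begin
    length (vietaExponents xs j ++ shift x (vietaExponents xs (suc j)))
      ≡⟨ List.length-++ (vietaExponents xs j) ⟩
    length (vietaExponents xs j) ℕ.+ length (shift x (vietaExponents xs (suc j)))
      ≡⟨ cong₂ ℕ._+_ (length-vietaExponents xs j)
                     (trans (length-shift x (vietaExponents xs (suc j))) (length-vietaExponents xs (suc j))) ⟩
    length xs C j ℕ.+ length xs C suc j
      ≡⟨ nCk+nC[k+1]≡[n+1]C[k+1] (length xs) j ⟩
    suc (length xs) C suc j ∎

  below : ℤ → ℕ → List ℤ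
  below c d = map (λ m → c ℤ.- + suc m) (downFrom d)

  above : ℕ → ℕ → List ℤ
  above i d = map (λ m → + (i ℕ.+ suc m)) (downFrom d)

  nodes : ℕ → ℕ → List ℤ
  nodes i r = below (+ i) i ++ above i r

  length-nodes : ∀ i r → length (nodes i r) ≡ i ℕ.+ r
  length-nodes i r = begin
    length (below (+ i) i ++ above i r)
      ≡⟨ List.length-++ (below (+ i) i) ⟩
    length (below (+ i) i) ℕ.+ length (above i r)
      ≡⟨ cong₂ ℕ._+_ (len (λ m → + i ℤ.- + suc m) i) (len (λ m → + (i ℕ.+ suc m)) r) ⟩
    i ℕ.+ r ∎
    where len : ∀ (f : ℕ → ℤ) d → length (map f (downFrom d)) ≡ d
          len f d = trans (List.length-map f (downFrom d)) (List.length-downFrom d)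

  ∈-nodes : ∀ {i r s} → s ≢ i → s ℕ.≤ i ℕ.+ r → + s ∈ nodes i r
  ∈-nodes {i} {r} {s} s≢i s≤i+r with ℕₚ.<-cmp s i
  ... | tri≈ _ s≡i _ = ⊥-elim (s≢i s≡i)
  ... | tri< s<i _ _ with o , s+1+o≡i ← ℕₚ.m≤n⇒∃[o]m+o≡n s<i =
    ∈-++⁺ˡ (subst (_∈ below (+ i) i) below≡s (∈-map⁺ _ (∈-downFrom⁺ o<i)))
    where
    o<i : o ℕ.< i
    o<i = subst (o ℕ.<_) s+1+o≡i (ℕ.s≤s (ℕₚ.m≤n+m o s))
    below≡s : + i ℤ.- + suc o ≡ + s
    below≡s = begin
      + i ℤ.- + suc o              ≡⟨ cong (λ n → + n ℤ.- + suc o) (trans (sym s+1+o≡i) (sym (ℕₚ.+-suc s o))) ⟩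
      + s ℤ.+ + suc o ℤ.- + suc o  ≡⟨ cancel (+ s) (+ suc o) ⟩
      + s                          ∎
      where cancel : ∀ a b → a ℤ.+ b ℤ.- b ≡ a
            cancel = ℤ-Solver.solve-∀
  ... | tri> _ _ i<s with o , i+1+o≡s ← ℕₚ.m≤n⇒∃[o]m+o≡n i<s =
    ∈-++⁺ʳ (below (+ i) i) (subst (_∈ above i r) (cong +_ above≡s) (∈-map⁺ _ (∈-downFrom⁺ o<r)))
    where
    above≡s : i ℕ.+ suc o ≡ s
    above≡s = trans (ℕₚ.+-suc i o) i+1+o≡s
    o<r : o ℕ.< r
    o<r = ℕₚ.+-cancelˡ-≤ i (suc o) r (subst (ℕ._≤ i ℕ.+ r) (sym above≡s) s≤i+r)

  exponentSum : List ℤ → ℤ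
  exponentSum = foldr ℤ._+_ (+ 0)

  lagrangeShift : ℕ → ℕ → ℤ
  lagrangeShift i r = - (exponentSum (below (+ i) i) ℤ.+ + (r ℕ.* i))

  lagrangeExponents : ℕ → ℕ → ℕ → List ℤ
  lagrangeExponents i r j = shift (lagrangeShift i r) (qBinomial i r ⊠ vietaExponents (nodes i r) j)

  length-lagrangeExponents : ∀ i r j →
    length (lagrangeExponents i r j) ≡ ((i ℕ.+ r) C i) ℕ.* ((i ℕ.+ r) C j)
  length-lagrangeExponents i r j = begin
    length (lagrangeExponents i r j)
      ≡⟨ length-shift (lagrangeShift i r) (qBinomial i r ⊠ vietaExponents (nodes i r) j) ⟩
    length (qBinomial i r ⊠ vietaExponents (nodes i r) j)
      ≡⟨ length-⊠ (qBinomial i r) (vietaExponents (nodes i r) j) ⟩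
    length (qBinomial i r) ℕ.* length (vietaExponents (nodes i r) j)
      ≡⟨ cong₂ ℕ._*_ (length-qBinomial i r)
                     (trans (length-vietaExponents (nodes i r) j) (cong (_C j) (length-nodes i r))) ⟩
    ((i ℕ.+ r) C i) ℕ.* ((i ℕ.+ r) C j) ∎

-- Lagrange interpolation at the powers of q

module _ where
  open import Relation.Binary.Reasoning.Setoid R.setoid

  sign : ℕ → LPoly
  sign m = constant ((- + 1) ℤ.^ m)

  sign-+ : ∀ m n → sign (m ℕ.+ n) ≋ sign m *ₗ sign n
  sign-+ zero    n = R.sym (R.*-identityˡ (sign n))
  sign-+ (suc m) n = R.trans (R.-‿cong (sign-+ m n)) (-‿distribˡ-* (sign m) (sign n))

  sign-double : ∀ n → sign (n ℕ.+ n) ≋ 1ₗ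
  sign-double zero    = R.refl
  sign-double (suc n) = begin
    sign (suc n ℕ.+ suc n)    ≡⟨ cong (λ m → -ₗ sign m) (ℕₚ.+-suc n n) ⟩
    -ₗ -ₗ sign (n ℕ.+ n)      ≈⟨ -‿involutive (sign (n ℕ.+ n)) ⟩
    sign (n ℕ.+ n)            ≈⟨ sign-double n ⟩
    1ₗ                        ∎

  sign-+-double : ∀ m n → sign (m ℕ.+ (n ℕ.+ n)) ≋ sign m
  sign-+-double m n = begin
    sign (m ℕ.+ (n ℕ.+ n))     ≈⟨ sign-+ m (n ℕ.+ n) ⟩
    sign m *ₗ sign (n ℕ.+ n)   ≈⟨ R.*-congˡ {sign m} (sign-double n) ⟩
    sign m *ₗ 1ₗ               ≈⟨ R.*-identityʳ (sign m) ⟩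
    sign m                     ∎

  qBinomial-prodFactor : ∀ i r →
    sumOfPowers (qBinomial i r) *ₗ prodFactor i *ₗ prodFactor r ≋ prodFactor (i ℕ.+ r)
  qBinomial-prodFactor zero    r       = unit (prodFactor r)
    where unit : ∀ p → 1ₗ *ₗ 1ₗ *ₗ p ≋ p
          unit = solve-∀ laurentSolverRing
  qBinomial-prodFactor (suc i) zero    =
    R.trans (unit (prodFactor (suc i))) (R.reflexive (cong prodFactor (sym (ℕₚ.+-identityʳ (suc i)))))
    where unit : ∀ p → 1ₗ *ₗ p *ₗ 1ₗ ≋ p
          unit = solve-∀ laurentSolverRing
  qBinomial-prodFactor (suc i) (suc r) = begin
    sumOfPowers (qBinomial i (suc r) ++ shift (+ suc i) (qBinomial (suc i) r)) *ₗ F (suc i) *ₗ F (suc r)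
      ≡⟨ cong (λ p → p *ₗ F (suc i) *ₗ F (suc r))
              (trans (sumOfPowers-++ (qBinomial i (suc r)) _) (cong (A +ₗ_) (sumOfPowers-shift (+ suc i) _))) ⟩
    (A +ₗ x *ₗ B) *ₗ (F i *ₗ (x +ₗ -ₗ 1ₗ)) *ₗ (F r *ₗ (z +ₗ -ₗ 1ₗ))
      ≈⟨ expand A B (F i) (F r) x z ⟩
    A *ₗ F i *ₗ F (suc r) *ₗ (x +ₗ -ₗ 1ₗ) +ₗ B *ₗ F (suc i) *ₗ F r *ₗ (x *ₗ (z +ₗ -ₗ 1ₗ))
      ≈⟨ R.+-cong (R.*-congʳ (qBinomial-prodFactor i (suc r)))
                  (R.*-congʳ (R.trans (qBinomial-prodFactor (suc i) r)
                                      (R.reflexive (cong F (sym (ℕₚ.+-suc i r)))))) ⟩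
    F n *ₗ (x +ₗ -ₗ 1ₗ) +ₗ F n *ₗ (x *ₗ (z +ₗ -ₗ 1ₗ))
      ≈⟨ telescope (F n) x z ⟩
    F n *ₗ (x *ₗ z +ₗ -ₗ 1ₗ) ∎
    where
    F = prodFactor
    A = sumOfPowers (qBinomial i (suc r))
    B = sumOfPowers (qBinomial (suc i) r)
    x = qPow (+ suc i)
    z = qPow (+ suc r)
    n = i ℕ.+ suc r
    expand : ∀ A B Fi Fr x z →
      (A +ₗ x *ₗ B) *ₗ (Fi *ₗ (x +ₗ -ₗ 1ₗ)) *ₗ (Fr *ₗ (z +ₗ -ₗ 1ₗ))
        ≋ A *ₗ Fi *ₗ (Fr *ₗ (z +ₗ -ₗ 1ₗ)) *ₗ (x +ₗ -ₗ 1ₗ)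
          +ₗ B *ₗ (Fi *ₗ (x +ₗ -ₗ 1ₗ)) *ₗ Fr *ₗ (x *ₗ (z +ₗ -ₗ 1ₗ))
    expand = solve-∀ laurentSolverRing
    telescope : ∀ N x z → N *ₗ (x +ₗ -ₗ 1ₗ) +ₗ N *ₗ (x *ₗ (z +ₗ -ₗ 1ₗ)) ≋ N *ₗ (x *ₗ z +ₗ -ₗ 1ₗ)
    telescope = solve-∀ laurentSolverRing

  rootProduct : List ℤ → LPoly → LPoly
  rootProduct xs y = foldr (λ x p → (y +ₗ -ₗ qPow x) *ₗ p) 1ₗ xs

  vietaCoefficient : List ℤ → ℕ → LPoly
  vietaCoefficient xs j = sign (length xs ℕ.+ j) *ₗ sumOfPowers (vietaExponents xs j)

  -- Any N > length xs will do; the induction uses the hypothesis at both N and N + 1.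
  vieta : ∀ xs y N → length xs ℕ.< N → polyEval N (vietaCoefficient xs) y ≋ rootProduct xs y
  vieta []       y (suc N) _ =
    R.trans (polyEval-constant N {vietaCoefficient []} y (λ j → R.zeroʳ (sign (suc j)))) (R.*-identityˡ 1ₗ)
  vieta (x ∷ xs) y (suc N) (ℕ.s≤s n<N) = begin
    polyEval (suc N) (vietaCoefficient (x ∷ xs)) y
      ≈⟨ polyEval-linearFactor N {c} {vietaCoefficient (x ∷ xs)} (-ₗ qPow x) y
                               coefficient-zero coefficient-suc ⟩
    y *ₗ polyEval N c y +ₗ (-ₗ qPow x) *ₗ polyEval (suc N) c y
      ≈⟨ R.+-cong (R.*-congˡ {y} (vieta xs y N n<N))
                  (R.*-congˡ { -ₗ qPow x} (vieta xs y (suc N) (ℕₚ.m<n⇒m<1+n n<N))) ⟩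
    y *ₗ rootProduct xs y +ₗ (-ₗ qPow x) *ₗ rootProduct xs y
      ≈⟨ R.distribʳ (rootProduct xs y) y (-ₗ qPow x) ⟨
    rootProduct (x ∷ xs) y ∎
    where
    n = length xs
    c = vietaCoefficient xs
    E = vietaExponents xs

    coefficient-zero : vietaCoefficient (x ∷ xs) 0 ≋ (-ₗ qPow x) *ₗ c 0
    coefficient-zero = begin
      (-ₗ sign (n ℕ.+ 0)) *ₗ sumOfPowers (shift x (E 0))
        ≡⟨ cong ((-ₗ sign (n ℕ.+ 0)) *ₗ_) (sumOfPowers-shift x (E 0)) ⟩
      (-ₗ sign (n ℕ.+ 0)) *ₗ (qPow x *ₗ sumOfPowers (E 0))
        ≈⟨ swap (sign (n ℕ.+ 0)) (qPow x) (sumOfPowers (E 0)) ⟩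
      (-ₗ qPow x) *ₗ c 0 ∎
      where swap : ∀ s u P → (-ₗ s) *ₗ (u *ₗ P) ≋ (-ₗ u) *ₗ (s *ₗ P)
            swap = solve-∀ laurentSolverRing

    coefficient-suc : ∀ j → vietaCoefficient (x ∷ xs) (suc j) ≋ c j +ₗ (-ₗ qPow x) *ₗ c (suc j)
    coefficient-suc j = begin
      (-ₗ sign (n ℕ.+ suc j)) *ₗ sumOfPowers (E j ++ shift x (E (suc j)))
        ≡⟨ cong₂ (λ s P → (-ₗ s) *ₗ P) (cong sign (ℕₚ.+-suc n j))
                 (trans (sumOfPowers-++ (E j) _)
                        (cong (sumOfPowers (E j) +ₗ_) (sumOfPowers-shift x (E (suc j))))) ⟩
      (-ₗ -ₗ sign (n ℕ.+ j)) *ₗ (sumOfPowers (E j) +ₗ qPow x *ₗ sumOfPowers (E (suc j)))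
        ≈⟨ expand (sign (n ℕ.+ j)) (sumOfPowers (E j)) (qPow x) (sumOfPowers (E (suc j))) ⟩
      c j +ₗ (-ₗ qPow x) *ₗ ((-ₗ sign (n ℕ.+ j)) *ₗ sumOfPowers (E (suc j)))
        ≡⟨ cong (λ m → c j +ₗ (-ₗ qPow x) *ₗ (sign m *ₗ sumOfPowers (E (suc j)))) (sym (ℕₚ.+-suc n j)) ⟩
      c j +ₗ (-ₗ qPow x) *ₗ c (suc j) ∎
      where expand : ∀ s P u Q → (-ₗ -ₗ s) *ₗ (P +ₗ u *ₗ Q) ≋ s *ₗ P +ₗ (-ₗ u) *ₗ ((-ₗ s) *ₗ Q)
            expand = solve-∀ laurentSolverRing

  rootProduct-++ : ∀ xs ys y → rootProduct (xs ++ ys) y ≋ rootProduct xs y *ₗ rootProduct ys y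
  rootProduct-++ []       ys y = R.sym (R.*-identityˡ (rootProduct ys y))
  rootProduct-++ (x ∷ xs) ys y = R.trans (R.*-congˡ {y +ₗ -ₗ qPow x} (rootProduct-++ xs ys y))
                                         (R.sym (R.*-assoc (y +ₗ -ₗ qPow x) _ _))

  rootProduct-root : ∀ {x xs} → x ∈ xs → rootProduct xs (qPow x) ≋ 0ₗ
  rootProduct-root {x} (here {xs = xs} refl) =
    R.trans (R.*-congʳ {rootProduct xs (qPow x)} (R.-‿inverseʳ (qPow x))) (R.zeroˡ (rootProduct xs (qPow x)))
  rootProduct-root {x} (there {x = x′} x∈xs) =
    R.trans (R.*-congˡ {qPow x +ₗ -ₗ qPow x′} (rootProduct-root x∈xs))
            (R.zeroʳ (qPow x +ₗ -ₗ qPow x′))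

  rootProduct-below : ∀ c d →
    rootProduct (below c d) (qPow c) ≋ qPow (exponentSum (below c d)) *ₗ prodFactor d
  rootProduct-below c zero    = R.refl
  rootProduct-below c (suc d) = begin
    (qPow c +ₗ -ₗ qPow x) *ₗ rootProduct (below c d) (qPow c)
      ≈⟨ R.*-cong (R.+-congʳ { -ₗ qPow x} (R.reflexive (cong qPow (sym (cancel c (+ suc d))))))
                  (rootProduct-below c d) ⟩
    (qPow x *ₗ qPow (+ suc d) +ₗ -ₗ qPow x) *ₗ (qPow (exponentSum (below c d)) *ₗ prodFactor d)
      ≈⟨ factor (qPow x) (qPow (+ suc d)) (qPow (exponentSum (below c d))) (prodFactor d) ⟩
    qPow (exponentSum (below c (suc d))) *ₗ prodFactor (suc d) ∎
    where
    x = c ℤ.- + suc d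
    cancel : ∀ c e → c ℤ.- e ℤ.+ e ≡ c
    cancel = ℤ-Solver.solve-∀
    factor : ∀ u z v F → (u *ₗ z +ₗ -ₗ u) *ₗ (v *ₗ F) ≋ u *ₗ v *ₗ (F *ₗ (z +ₗ -ₗ 1ₗ))
    factor = solve-∀ laurentSolverRing

  rootProduct-above : ∀ i d →
    rootProduct (above i d) (qPow (+ i)) ≋ sign d *ₗ (qPow (+ (d ℕ.* i)) *ₗ prodFactor d)
  rootProduct-above i zero    = R.refl
  rootProduct-above i (suc d) = begin
    (u +ₗ -ₗ (u *ₗ qPow (+ suc d))) *ₗ rootProduct (above i d) u
      ≈⟨ R.*-congˡ {u +ₗ -ₗ (u *ₗ qPow (+ suc d))} (rootProduct-above i d) ⟩
    (u +ₗ -ₗ (u *ₗ qPow (+ suc d))) *ₗ (sign d *ₗ (qPow (+ (d ℕ.* i)) *ₗ prodFactor d))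
      ≈⟨ factor u (qPow (+ suc d)) (sign d) (qPow (+ (d ℕ.* i))) (prodFactor d) ⟩
    sign (suc d) *ₗ (qPow (+ (suc d ℕ.* i)) *ₗ prodFactor (suc d)) ∎
    where
    u = qPow (+ i)
    factor : ∀ u z s v F →
      (u +ₗ -ₗ (u *ₗ z)) *ₗ (s *ₗ (v *ₗ F)) ≋ (-ₗ s) *ₗ (u *ₗ v *ₗ (F *ₗ (z +ₗ -ₗ 1ₗ)))
    factor = solve-∀ laurentSolverRing

  -- ∏_{b ≤ i + r} (q^b − 1) / ∏_{x ∈ nodes i r} (q^i − q^x), by rootProduct-below/above
  -- and qBinomial-prodFactor.
  lagrangeScale : ℕ → ℕ → LPoly
  lagrangeScale i r = sign r *ₗ (qPow (lagrangeShift i r) *ₗ sumOfPowers (qBinomial i r))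

  lagrangeEntry : ℕ → ℕ → ℕ → LPoly
  lagrangeEntry i r j = scaleₗ (sgn i j) (sumOfPowers (lagrangeExponents i r j))

  lagrangeEntry-factor : ∀ i r j →
    lagrangeEntry i r j ≋ lagrangeScale i r *ₗ vietaCoefficient (nodes i r) j
  lagrangeEntry-factor i r j = begin
    scaleₗ (sgn i j) (sumOfPowers (lagrangeExponents i r j))
      ≈⟨ scale≋constant* (sgn i j) _ ⟩
    sign (i ℕ.+ j) *ₗ sumOfPowers (shift (lagrangeShift i r) (G ⊠ V))
      ≡⟨ cong (sign (i ℕ.+ j) *ₗ_) (trans (sumOfPowers-shift (lagrangeShift i r) (G ⊠ V))
                                          (cong (qPow (lagrangeShift i r) *ₗ_) (sumOfPowers-⊠ G V))) ⟩
    sign (i ℕ.+ j) *ₗ (qPow (lagrangeShift i r) *ₗ (sumOfPowers G *ₗ sumOfPowers V))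
      ≈⟨ R.*-congʳ signs ⟩
    sign r *ₗ sign (n ℕ.+ j) *ₗ (qPow (lagrangeShift i r) *ₗ (sumOfPowers G *ₗ sumOfPowers V))
      ≈⟨ regroup (sign r) (sign (n ℕ.+ j)) (qPow (lagrangeShift i r)) (sumOfPowers G) (sumOfPowers V) ⟩
    lagrangeScale i r *ₗ vietaCoefficient (nodes i r) j ∎
    where
    n = length (nodes i r)
    G = qBinomial i r
    V = vietaExponents (nodes i r) j
    signs : sign (i ℕ.+ j) ≋ sign r *ₗ sign (n ℕ.+ j)
    signs = begin
      sign (i ℕ.+ j)
        ≈⟨ sign-+-double (i ℕ.+ j) r ⟨
      sign (i ℕ.+ j ℕ.+ (r ℕ.+ r))
        ≡⟨ cong sign (trans (parity i j r) (cong (λ m → r ℕ.+ (m ℕ.+ j)) (sym (length-nodes i r)))) ⟩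
      sign (r ℕ.+ (n ℕ.+ j))
        ≈⟨ sign-+ r (n ℕ.+ j) ⟩
      sign r *ₗ sign (n ℕ.+ j) ∎
      where parity : ∀ i j r → i ℕ.+ j ℕ.+ (r ℕ.+ r) ≡ r ℕ.+ (i ℕ.+ r ℕ.+ j)
            parity = ℕ-Solver.solve-∀
    regroup : ∀ s t u G V → s *ₗ t *ₗ (u *ₗ (G *ₗ V)) ≋ s *ₗ (u *ₗ G) *ₗ (t *ₗ V)
    regroup = solve-∀ laurentSolverRing

  lagrangeRow : ∀ i r N y → i ℕ.+ r ℕ.< N →
    polyEval N (lagrangeEntry i r) y ≋ lagrangeScale i r *ₗ rootProduct (nodes i r) y
  lagrangeRow i r N y i+r<N = begin
    polyEval N (lagrangeEntry i r) y
      ≈⟨ polyEval-cong N y (lagrangeEntry-factor i r) ⟩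
    polyEval N (λ j → lagrangeScale i r *ₗ vietaCoefficient (nodes i r) j) y
      ≈⟨ polyEval-*ˡ N (lagrangeScale i r) (vietaCoefficient (nodes i r)) y ⟩
    lagrangeScale i r *ₗ polyEval N (vietaCoefficient (nodes i r)) y
      ≈⟨ R.*-congˡ {lagrangeScale i r}
                   (vieta (nodes i r) y N (subst (ℕ._< N) (sym (length-nodes i r)) i+r<N)) ⟩
    lagrangeScale i r *ₗ rootProduct (nodes i r) y ∎

  lagrangeRow-diagonal : ∀ i r →
    lagrangeScale i r *ₗ rootProduct (nodes i r) (qPow (+ i)) ≋ prodFactor (i ℕ.+ r)
  lagrangeRow-diagonal i r = begin
    lagrangeScale i r *ₗ rootProduct (below (+ i) i ++ above i r) (qPow (+ i))
      ≈⟨ R.*-congˡ {lagrangeScale i r} (R.trans (rootProduct-++ (below (+ i) i) (above i r) (qPow (+ i)))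
                                                (R.*-cong (rootProduct-below (+ i) i) (rootProduct-above i r))) ⟩
    sign r *ₗ (qPow shift′ *ₗ G) *ₗ (qPow eL *ₗ prodFactor i *ₗ (sign r *ₗ (qPow eU *ₗ prodFactor r)))
      ≈⟨ regroup (sign r) (qPow shift′) (qPow eL) (qPow eU) G (prodFactor i) (prodFactor r) ⟩
    sign r *ₗ sign r *ₗ qPow (shift′ ℤ.+ (eL ℤ.+ eU)) *ₗ (G *ₗ prodFactor i *ₗ prodFactor r)
      ≈⟨ R.*-cong (R.*-cong (R.trans (R.sym (sign-+ r r)) (sign-double r))
                            (R.reflexive (cong qPow (ℤₚ.+-inverseˡ (eL ℤ.+ eU)))))
                  (qBinomial-prodFactor i r) ⟩
    1ₗ *ₗ 1ₗ *ₗ prodFactor (i ℕ.+ r)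
      ≈⟨ unit (prodFactor (i ℕ.+ r)) ⟩
    prodFactor (i ℕ.+ r) ∎
    where
    shift′ = lagrangeShift i r
    eL = exponentSum (below (+ i) i)
    eU = + (r ℕ.* i)
    G = sumOfPowers (qBinomial i r)
    regroup : ∀ s u v w G Fi Fr →
      s *ₗ (u *ₗ G) *ₗ (v *ₗ Fi *ₗ (s *ₗ (w *ₗ Fr))) ≋ s *ₗ s *ₗ (u *ₗ (v *ₗ w)) *ₗ (G *ₗ Fi *ₗ Fr)
    regroup = solve-∀ laurentSolverRing
    unit : ∀ p → 1ₗ *ₗ 1ₗ *ₗ p ≋ p
    unit = solve-∀ laurentSolverRing

  lagrangeRow-offDiagonal : ∀ i r s → s ≢ i → s ℕ.≤ i ℕ.+ r →
    lagrangeScale i r *ₗ rootProduct (nodes i r) (qPow (+ s)) ≋ 0ₗ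
  lagrangeRow-offDiagonal i r s s≢i s≤i+r =
    R.trans (R.*-congˡ {lagrangeScale i r} (rootProduct-root (∈-nodes s≢i s≤i+r)))
            (R.zeroʳ (lagrangeScale i r))

-- ∏ (q^b − 1) is not a zero divisor

maxExponent : LPoly → ℤ
maxExponent []            = + 0
maxExponent ((c , e) ∷ p) = e ℤ.⊔ maxExponent p

coeff-beyond-max : ∀ p m → maxExponent p ℤ.< m → coeff p m ≡ + 0
coeff-beyond-max []            m _       = refl
coeff-beyond-max ((c , e) ∷ p) m max<m with e ℤ.≟ m
... | yes refl = ⊥-elim (ℤₚ.<-irrefl refl (ℤₚ.≤-<-trans (ℤₚ.i≤i⊔j e (maxExponent p)) max<m))
... | no  _    = coeff-beyond-max p m (ℤₚ.≤-<-trans (ℤₚ.i≤j⊔i e (maxExponent p)) max<m)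

-- The coefficient of q^(m+b) in (q^b − 1) a is coeff a m − coeff a (m + b).
coeff-periodic : ∀ b a → (qPow (+ suc b) +ₗ -ₗ 1ₗ) *ₗ a ≋ 0ₗ → ∀ m → coeff a m ≡ coeff a (m ℤ.+ + suc b)
coeff-periodic b a (≈⇒≋ vanishes) m = begin
  coeff a m                ≡⟨ cong (coeff a) (sym (cancel m (+ suc b))) ⟩
  coeff a (n ℤ.- + suc b)  ≡⟨ difference≡0 (trans (sym (coeff-* (qPow (+ suc b) +ₗ -ₗ 1ₗ) a n)) (vanishes n)) ⟩
  coeff a (n ℤ.- + 0)      ≡⟨ cong (coeff a) (ℤₚ.+-identityʳ n) ⟩
  coeff a n                ∎
  where
  open ≡-Reasoning
  n = m ℤ.+ + suc b
  cancel : ∀ m s → m ℤ.+ s ℤ.- s ≡ m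
  cancel = ℤ-Solver.solve-∀
  difference≡0 : ∀ {x y} → + 1 ℤ.* x ℤ.+ ((- + 1 ℤ.* + 1) ℤ.* y ℤ.+ + 0) ≡ + 0 → x ≡ y
  difference≡0 {x} {y} eq = trans (rearrange x y) (trans (cong (ℤ._+ y) eq) (ℤₚ.+-identityˡ y))
    where rearrange : ∀ x y → x ≡ + 1 ℤ.* x ℤ.+ ((- + 1 ℤ.* + 1) ℤ.* y ℤ.+ + 0) ℤ.+ y
          rearrange = ℤ-Solver.solve-∀

-- A periodic coefficient sequence that vanishes beyond maxExponent vanishes everywhere.
qPow-1-cancel : ∀ b a → (qPow (+ suc b) +ₗ -ₗ 1ₗ) *ₗ a ≋ 0ₗ → a ≋ 0ₗ
qPow-1-cancel b a vanishes = ≈⇒≋ λ m →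
  trans (periodic (periods m) m) (coeff-beyond-max a _ (beyond m))
  where
  periods : ℤ → ℕ
  periods m = suc ℤ.∣ maxExponent a ℤ.- m ∣

  periodic : ∀ t m → coeff a m ≡ coeff a (m ℤ.+ + (t ℕ.* suc b))
  periodic zero    m = cong (coeff a) (sym (ℤₚ.+-identityʳ m))
  periodic (suc t) m =
    trans (periodic t m) (trans (coeff-periodic b a vanishes _) (cong (coeff a) (reassoc m _ _)))
    where reassoc : ∀ m x y → m ℤ.+ x ℤ.+ y ≡ m ℤ.+ (y ℤ.+ x)
          reassoc = ℤ-Solver.solve-∀

  beyond : ∀ m → maxExponent a ℤ.< m ℤ.+ + (periods m ℕ.* suc b)
  beyond m = begin-strict
    maxExponent a                   ≡⟨ split (maxExponent a) m ⟩
    m ℤ.+ (maxExponent a ℤ.- m)     ≤⟨ ℤₚ.+-monoʳ-≤ m (i≤+∣i∣ (maxExponent a ℤ.- m)) ⟩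
    m ℤ.+ + ℤ.∣ maxExponent a ℤ.- m ∣ <⟨ ℤₚ.+-monoʳ-< m (ℤ.+<+ (ℕₚ.n<1+n _)) ⟩
    m ℤ.+ + periods m               ≤⟨ ℤₚ.+-monoʳ-≤ m (ℤ.+≤+ (ℕₚ.m≤m*n (periods m) (suc b))) ⟩
    m ℤ.+ + (periods m ℕ.* suc b)   ∎
    where
    open ℤₚ.≤-Reasoning
    split : ∀ u m → u ≡ m ℤ.+ (u ℤ.- m)
    split = ℤ-Solver.solve-∀
    i≤+∣i∣ : ∀ i → i ℤ.≤ + ℤ.∣ i ∣
    i≤+∣i∣ (+ n)    = ℤₚ.≤-refl
    i≤+∣i∣ -[1+ n ] = ℤ.-≤+

prodFactor-cancel : ∀ k a → prodFactor k *ₗ a ≋ 0ₗ → a ≋ 0ₗ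
prodFactor-cancel zero    a vanishes = R.trans (R.sym (R.*-identityˡ a)) vanishes
prodFactor-cancel (suc k) a vanishes =
  qPow-1-cancel k a (prodFactor-cancel k _ (R.trans (R.sym (R.*-assoc (prodFactor k) _ a)) vanishes))

prodFactor-cancelˡ : ∀ k {a b} → prodFactor k *ₗ a ≋ prodFactor k *ₗ b → a ≋ b
prodFactor-cancelˡ k {a} {b} Fa≋Fb = x∙y⁻¹≈ε⇒x≈y a b (prodFactor-cancel k (a +ₗ -ₗ b) (begin
  F *ₗ (a +ₗ -ₗ b)           ≈⟨ R.distribˡ F a (-ₗ b) ⟩
  F *ₗ a +ₗ F *ₗ (-ₗ b)      ≈⟨ R.+-cong Fa≋Fb (R.sym (-‿distribʳ-* F b)) ⟩
  F *ₗ b +ₗ -ₗ (F *ₗ b)      ≈⟨ R.-‿inverseʳ (F *ₗ b) ⟩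
  0ₗ                         ∎))
  where
  open import Relation.Binary.Reasoning.Setoid R.setoid
  F = prodFactor k

-- The scaled inverse of the Vandermonde matrix

module _ {n : ℕ} where
  open import Data.Fin using (zero; suc)
  open import Data.List using (tabulate)
  open import Algebra.Properties.Semiring.Sum R.semiring using (sum)

  ⊗≡· : (A B : Mat n) → ∀ r s → (A ⊗ B) r s ≡ (A · B) r s
  ⊗≡· A B r s = foldr-tabulate (λ t → t)
    where
    foldr-tabulate : ∀ {m} (g : Fin m → Fin n) →
      foldr (λ t acc → A r t *ₗ B t s +ₗ acc) 0ₗ (tabulate g) ≡ sum (λ t → A r (g t) *ₗ B (g t) s)
    foldr-tabulate {zero}  g = refl
    foldr-tabulate {suc m} g = cong (A r (g zero) *ₗ B (g zero) s +ₗ_) (foldr-tabulate (g ∘ suc))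

  IsScalar⇒≈ₘscalarMat : ∀ {p} (A B : Mat n) → IsScalar p (A · B) → A ⊗ B ≈ₘ scalarMat p
  IsScalar⇒≈ₘscalarMat {p} A B (diagonal , offDiagonal) r s with r ≟ᶠ s
  ... | yes refl = subst (_≈ₗ p) (sym (⊗≡· A B r r)) (≋⇒≈ (diagonal r))
  ... | no  r≢s  = subst (_≈ₗ 0ₗ) (sym (⊗≡· A B r s)) (≋⇒≈ (offDiagonal r s r≢s))

vandermonde-symmetric : ∀ n r s → vandermonde n r s ≋ vandermonde n s r
vandermonde-symmetric n r s = R.reflexive (cong (qPow ∘ +_) (ℕₚ.*-comm (toℕ r) (toℕ s)))

qPow-^ : ∀ j s → qPow (+ (j ℕ.* s)) ≋ qPow (+ s) ^ j
qPow-^ zero    s = R.refl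
qPow-^ (suc j) s = R.*-congˡ {qPow (+ s)} (qPow-^ j s)

module _ (k : ℕ) where
  open import Data.Fin.Properties using (toℕ-injective; toℕ≤pred[n])
  open import Algebra.Properties.Semiring.Sum R.semiring using (sum-cong-≋)

  r : Fin (suc k) → ℕ
  r i = k ℕ.∸ toℕ i

  i+r≡k : ∀ i → toℕ i ℕ.+ r i ≡ k
  i+r≡k i = ℕₚ.m+[n∸m]≡n (toℕ≤pred[n] i)

  inverseExponents : Fin (suc k) → Fin (suc k) → List ℤ
  inverseExponents i j = lagrangeExponents (toℕ i) (r i) (toℕ j)

  scaledInverse : Mat (suc k)
  scaledInverse i j = scaleₗ (sgn (toℕ i) (toℕ j)) (sumOfPowers (inverseExponents i j))

  length-inverseExponents : ∀ i j → length (inverseExponents i j) ≡ (k C toℕ i) ℕ.* (k C toℕ j)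
  length-inverseExponents i j =
    subst (λ n → length (inverseExponents i j) ≡ (n C toℕ i) ℕ.* (n C toℕ j)) (i+r≡k i)
          (length-lagrangeExponents (toℕ i) (r i) (toℕ j))

  scaledInverse·vandermonde : IsScalar (prodFactor k) (scaledInverse · vandermonde (suc k))
  scaledInverse·vandermonde = diagonal , offDiagonal
    where
    row : ∀ i s → (scaledInverse · vandermonde (suc k)) i s
                    ≋ lagrangeScale (toℕ i) (r i) *ₗ rootProduct (nodes (toℕ i) (r i)) (qPow (+ toℕ s))
    row i s = R.trans (sum-cong-≋ {suc k} (λ t → R.*-congˡ {scaledInverse i t} (qPow-^ (toℕ t) (toℕ s))))
                      (lagrangeRow (toℕ i) (r i) (suc k) (qPow (+ toℕ s)) (ℕ.s≤s (ℕₚ.≤-reflexive (i+r≡k i))))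

    diagonal : ∀ i → (scaledInverse · vandermonde (suc k)) i i ≋ prodFactor k
    diagonal i = R.trans (row i i) (R.trans (lagrangeRow-diagonal (toℕ i) (r i))
                                            (R.reflexive (cong prodFactor (i+r≡k i))))

    offDiagonal : ∀ i s → i ≢ s → (scaledInverse · vandermonde (suc k)) i s ≋ 0ₗ
    offDiagonal i s i≢s = R.trans (row i s) (lagrangeRow-offDiagonal (toℕ i) (r i) (toℕ s)
      (λ s≡i → i≢s (toℕ-injective (sym s≡i)))
      (subst (toℕ s ℕ.≤_) (sym (i+r≡k i)) (toℕ≤pred[n] s)))

  vandermonde·scaledInverse : IsScalar (prodFactor k) (vandermonde (suc k) · scaledInverse)
  vandermonde·scaledInverse = ·-comm-scalar scaledInverse (vandermonde (suc k))
    (prodFactor-cancelˡ k) (vandermonde-symmetric (suc k)) scaledInverse·vandermonde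

open import Data.Nat using (_≤_; _*_)

mainTheorem15 : (k : ℕ) → 1 ≤ k →
    Σ (Fin (suc k) → Fin (suc k) → List ℤ) λ L →
      ((i j : Fin (suc k)) → length (L i j) ≡ (k C toℕ i) * (k C toℕ j))
      × (vandermonde (suc k) ⊗ (λ i j → scaleₗ (sgn (toℕ i) (toℕ j)) (sumOfPowers (L i j)))
           ≈ₘ scalarMat (prodFactor k))
      × ((λ i j → scaleₗ (sgn (toℕ i) (toℕ j)) (sumOfPowers (L i j))) ⊗ vandermonde (suc k)
           ≈ₘ scalarMat (prodFactor k))
mainTheorem15 k _ =
  inverseExponents k ,
  length-inverseExponents k ,
  IsScalar⇒≈ₘscalarMat (vandermonde (suc k)) (scaledInverse k) (vandermonde·scaledInverse k) ,
  IsScalar⇒≈ₘscalarMat (scaledInverse k) (vandermonde (suc k)) (scaledInverse·vandermonde k)
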